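{- Let $Z:\mathfrak{H}^0\to\mathbb{R}$ be a $\mathbb{Q}$-linear map (no multiplicativity assumed) such that $Z\bigl(\mu(\mathbf{k},\mathbf{l})\bigr)=Z\bigl(\mathbf{k}\circledast\mathbf{l}^\star\bigr)$ for all non-empty indices $\mathbf{k},\mathbf{l}$. Then for all integers $k>q>0$, \[\sum_{\substack{k_1,\dots,k_{q-1}\ge1,\ k_q\ge2\\ k_1+\cdots+k_q=k}}Z(k_1,\dots,k_q)=Z(k).\]
   Context: Let $\mathfrak{H}=\mathbb{Q}\langle e_0,e_1\rangle$, $\mathfrak{H}^1=\mathbb{Q}+e_1\mathfrak{H}$, $\mathfrak{H}^0=\mathbb{Q}+e_1\mathfrak{H}e_0$, $e_k=e_1e_0^{k-1}$. Indices (finite possibly empty sequences $(k_1,\dots,k_r)$ of positive integers) are identified with words $e_{k_1}\cdots e_{k_r}$, so $Z(k_1,\dots,k_r)$ means $Z(e_{k_1}\cdots e_{k_r})$; maps are extended linearly. Harmonic $*$ on $\mathfrak{H}^1$: $1*w=w*1=w$, $e_kv*e_lw=e_k(v*e_lw)+e_l(e_kv*w)+e_{k+l}(v*w)$. $\circledast:e_1\mathfrak{H}\times e_1\mathfrak{H}\to e_1\mathfrak{H}e_0$ bilinear with $ve_k\circledast we_l=(v*w)e_{k+l}$. For non-empty $\mathbf{l}=(l_1,\dots,l_s)$, $\mathbf{l}^\star$ is the sum of the $2^{s-1}$ indices $(l_1\bigcirc\cdots\bigcirc l_s)$, each $\bigcirc$ a comma or plus. A 2-poset is a finite poset with labels $\delta:X\to\{0,1\}$;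 $W(X)$ is the sum over all linear extensions $x_1,\dots,x_n$ of $e_{\delta(x_1)}\cdots e_{\delta(x_n)}$. For non-empty $\mathbf{k}=(k_1,\dots,k_r)$ of weight $K$ and non-empty $\mathbf{l}=(l_1,\dots,l_s)$, $\mu(\mathbf{k},\mathbf{l})=W(Q)$ where $Q$ has elements $a_1,\dots,a_K$, $b_{j,i}$ ($1\le j\le s$, $1\le i\le l_j$), order generated by $a_1<\cdots<a_K<b_{s,1}$, $b_{j,1}<\cdots<b_{j,l_j}$, $b_{j-1,1}<b_{j,l_j}$ ($2\le j\le s$), labels $\delta(a_t)=1$ iff $t\in\{1,k_1+1,\dots,k_1+\dots+k_{r-1}+1\}$ (else 0), $\delta(b_{s,1})=0$, $\delta(b_{j,1})=1$ ($j<s$), $\delta(b_{j,i})=0$ ($i\ge2$). -}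

module Defs where

open import Level using (Level)
open import Data.Bool using (Bool; true; false; _∧_; _∨_; not; if_then_else_)
open import Data.Nat using (ℕ; zero; suc; _+_; _∸_; _≡ᵇ_; _≤ᵇ_)
open import Data.List using (List; []; _∷_; [_]; _++_; map; concatMap; foldr; replicate; applyUpTo; filterᵇ; length)
open import Data.Bool.ListAction using (any)
open import Data.Nat.ListAction using (sum)
open import Algebra.Module.Bundles using (Module)
open import Data.Rational.Properties using (+-*-commutativeRing)

-- Words in the letters e₀, e₁ (monomials of 𝔥 = ℚ⟨e₀,e₁⟩)

data Letter : Set where
  e₀ e₁ : Letter

Word : Set
Word = List Letter

-- A formal ℕ-linear combination of words, written as a list of words
-- (each occurrence contributes coefficient 1).
FSum : Set
FSum = List Word

-- An index (k₁,…,k_r) is a list of natural numbers (positivity is imposed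
-- separately where needed).  Formal sums of indices are lists of indices.
Index : Set
Index = List ℕ

eWord : ℕ → Word
eWord k = e₁ ∷ replicate (k ∸ 1) e₀

indexWord : Index → Word
indexWord = concatMap eWord

infixl 7 _*h_
_*h_ : Index → Index → List Index
[] *h w = [ w ]
(k ∷ v) *h w = go w
  where
  go : Index → List Index
  go [] = [ k ∷ v ]
  go (l ∷ w′) = map (k ∷_) (v *h (l ∷ w′))
             ++ map (l ∷_) (go w′)
             ++ map ((k + l) ∷_) (v *h w′)

data SnocView : Index → Set where
  nil  : SnocView []
  snoc : (v : Index) (k : ℕ) → SnocView (v ++ [ k ])

snocView : (xs : Index) → SnocView xs
snocView [] = nil
snocView (x ∷ xs) with snocView xs
... | nil = snoc [] x
... | snoc v k = snoc (x ∷ v) k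

_⊛_ : Index → Index → List Index
a ⊛ b with snocView a | snocView b
... | snoc v k | snoc w l = map (_++ [ k + l ]) (v *h w)
... | nil      | _        = []
... | snoc _ _ | nil      = []

-- 𝐥^⋆ : sum over all ways of replacing commas by commas or pluses
starFrom : ℕ → Index → List Index
starFrom acc [] = [ [ acc ] ]
starFrom acc (l ∷ ls) = map (acc ∷_) (starFrom l ls) ++ starFrom (acc + l) ls

star : Index → List Index
star [] = []
star (l ∷ ls) = starFrom l ls

⊛star : Index → Index → List Index
⊛star k l = concatMap (k ⊛_) (star l)

-- all permutations of a list (distinct entries give distinct permutations)
insertions : {A : Set} → A → List A → List (List A)
insertions x [] = [ [ x ] ]
insertions x (y ∷ ys) = (x ∷ y ∷ ys) ∷ map (y ∷_) (insertions x ys)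

perms : {A : Set} → List A → List (List A)
perms [] = [ [] ]
perms (x ∷ xs) = concatMap (insertions x) (perms xs)

-- A finite 2-poset presented by its list of (distinct) elements, a
-- generating relation `gen x y` (meaning x < y is one of the generating
-- relations of the order) and the labelling δ.
record TwoPoset : Set₁ where
  field
    Elem   : Set
    elems  : List Elem
    gen    : Elem → Elem → Bool
    label  : Elem → Letter

respects : {E : Set} → (E → E → Bool) → List E → Bool
respects g [] = true
respects g (x ∷ xs) = not (any (λ y → g y x) xs) ∧ respects g xs

linearExtensions : (X : TwoPoset) → List (List (TwoPoset.Elem X))
linearExtensions X = filterᵇ (respects gen) (perms elems)
  where open TwoPoset X

W : TwoPoset → FSum
W X = map (map label) (linearExtensions X)
  where open TwoPoset X

data QElem : Set where
  a : ℕ → QElem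
  b : ℕ → ℕ → QElem

-- 1-based lookup l_j (0 if out of range; never used out of range)
nth1 : Index → ℕ → ℕ
nth1 [] _ = 0
nth1 (x ∷ xs) zero = 0
nth1 (x ∷ xs) (suc zero) = x
nth1 (x ∷ xs) (suc (suc j)) = nth1 xs (suc j)

range1 : ℕ → List ℕ
range1 = applyUpTo suc

starts : Index → List ℕ
starts [] = []
starts (k ∷ ks) = 1 ∷ map (k +_) (starts ks)

Q : Index → Index → TwoPoset
Q 𝐤 𝐥 = record
  { Elem  = QElem
  ; elems = map a (range1 K)
            ++ concatMap (λ j → map (b j) (range1 (nth1 𝐥 j))) (range1 s)
  ; gen   = g
  ; label = δ
  }
  where
  K s : ℕ
  K = sum 𝐤
  s = length 𝐥
  g : QElem → QElem → Bool
  g (a t) (a t′) = t′ ≡ᵇ suc t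
  g (a t) (b j i) = (t ≡ᵇ K) ∧ (j ≡ᵇ s) ∧ (i ≡ᵇ 1)
  g (b j i) (a _) = false
  g (b j i) (b j′ i′) = ((j′ ≡ᵇ j) ∧ (i′ ≡ᵇ suc i))
                      ∨ ((j′ ≡ᵇ suc j) ∧ (i ≡ᵇ 1) ∧ (i′ ≡ᵇ nth1 𝐥 j′))
  δ : QElem → Letter
  δ (a t) = if any (t ≡ᵇ_) (starts 𝐤) then e₁ else e₀
  δ (b j i) = if (i ≡ᵇ 1) ∧ not (j ≡ᵇ s) then e₁ else e₀

μ : Index → Index → FSum
μ 𝐤 𝐥 = W (Q 𝐤 𝐥)

comps : ℕ → ℕ → List Index
comps zero zero = [ [] ]
comps zero (suc n) = []
comps (suc q) n = concatMap (λ c → map (suc c ∷_) (comps q (n ∸ suc c))) (applyUpTo (λ i → i) n)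

lastAtLeast2 : Index → Bool
lastAtLeast2 [] = false
lastAtLeast2 (x ∷ []) = 2 ≤ᵇ x
lastAtLeast2 (x ∷ y ∷ ys) = lastAtLeast2 (y ∷ ys)

admissibleComps : ℕ → ℕ → List Index
admissibleComps q k = filterᵇ lastAtLeast2 (comps q k)

ℚModule : (m ℓm : Level) → Set _
ℚModule m ℓm = Module +-*-commutativeRing m ℓm

Zsum : ∀ {m ℓm} (M : ℚModule m ℓm) → (Word → Module.Carrierᴹ M) → FSum → Module.Carrierᴹ M
Zsum M Z = foldr (λ w acc → Z w +ᴹ acc) 0ᴹ
  where open Module M

Zidx : ∀ {m ℓm} (M : ℚModule m ℓm) → (Word → Module.Carrierᴹ M) → List Index → Module.Carrierᴹ M
Zidx M Z ks = Zsum M Z (map indexWord ks)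

-- For 𝐤 = (1^r) and 𝐥 = (1^p, n) the 2-poset Q(𝐤, 𝐥) is two chains below a common top, so μ(𝐤, 𝐥) is
-- (e₁^r e₀^(n-1) ш e₁^p) e₀.  Splitting off the first letter gives, for r ≥ 1,
--   μ((1^r), (1^(p+1), n)) = w(r-1, p+1) + w(r, p)   and   μ((1^r), (n)) = w(r-1, 0),
-- where w(r, p) = e₁ (e₁^r e₀^(n-1) ш e₁^p) e₀.  Expanding the harmonic products, (1^r) ⊛ (1^(p+1), n)^⋆
-- satisfies the same recurrence for index families i(r, p) with i(0, p) = (p + n + 1).  The hypothesis
-- identifies Z of the two left-hand sides, and a solution of such a recurrence in a group is
-- determined by its boundary values, so Z(w(0, q-1)) = Z(i(0, q-1)) = Z(k) for k = q + n.  The words of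
-- w(0, q-1) = e₁ (e₀^(n-1) ш e₁^(q-1)) e₀ are exactly the admissible indices of depth q and weight k.

module Submission where

open import Defs
open import Level using (Level)
open import Data.Nat using (ℕ; _<_; _≤_)
open import Data.List using (List; []; [_])
open import Data.List.Relation.Unary.All using (All)
open import Relation.Binary.PropositionalEquality using (_≢_)
open import Algebra.Module.Bundles using (Module)

open import Algebra.Bundles using (CommutativeMonoid; Group)
open import Data.Bool using (Bool; true; false; _∧_; _∨_; not; if_then_else_)
import Data.Bool.Properties as Bool
open import Data.Bool.ListAction using (any; or)
open import Data.Empty using (⊥-elim)
open import Data.Nat using (zero; suc; _+_; _∸_; _≡ᵇ_; z≤n; s≤s)
import Data.Nat.Properties as ℕ
open import Data.Nat.ListAction using (sum)
open import Data.Product using (_×_; _,_)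
open import Data.List using (_∷_; _++_; map; concat; concatMap; filterᵇ; replicate; applyUpTo; length; foldr)
import Data.List.Properties as List
open import Data.List.Relation.Unary.All using ([]; _∷_)
import Data.List.Relation.Unary.All as All
import Data.List.Relation.Unary.All.Properties as All
open import Data.List.Relation.Binary.Permutation.Propositional
  using (_↭_; ↭-refl; ↭-sym; ↭-trans; ↭-reflexive; prep; swap; module PermutationReasoning)
import Data.List.Relation.Binary.Permutation.Propositional as Perm
open import Data.List.Relation.Binary.Permutation.Propositional.Properties
  using (++⁺ˡ; ++⁺; shifts; ++-comm; ++-assoc; map⁺)
open import Relation.Nullary.Decidable using (dec-true; dec-false)
open import Relation.Binary.PropositionalEquality
  using (_≡_; refl; sym; trans; cong; cong₂; subst; module ≡-Reasoning)

∧-falseˡ : ∀ {x y} → x ≡ false → (x ∧ y) ≡ false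
∧-falseˡ refl = refl

∧-falseʳ : ∀ {x y} → y ≡ false → (x ∧ y) ≡ false
∧-falseʳ {x} refl = Bool.∧-zeroʳ x

∨-false : ∀ {x y} → x ≡ false → y ≡ false → (x ∨ y) ≡ false
∨-false refl refl = refl

∧-true : ∀ {x y} → x ≡ true → y ≡ true → (x ∧ y) ≡ true
∧-true refl refl = refl

∨-trueˡ : ∀ {x y} → x ≡ true → (x ∨ y) ≡ true
∨-trueˡ refl = refl

∨-trueʳ : ∀ {x y} → y ≡ true → (x ∨ y) ≡ true
∨-trueʳ {x} refl = Bool.∨-zeroʳ x

≡ᵇ-refl : ∀ m → (m ≡ᵇ m) ≡ true
≡ᵇ-refl m = dec-true (m ℕ.≟ m) refl

≢⇒≡ᵇ-false : ∀ {m n} → m ≢ n → (m ≡ᵇ n) ≡ false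
≢⇒≡ᵇ-false {m} {n} = dec-false (m ℕ.≟ n)

<⇒≡ᵇ-false : ∀ {m n} → m < n → (m ≡ᵇ n) ≡ false
<⇒≡ᵇ-false m<n = ≢⇒≡ᵇ-false (ℕ.<⇒≢ m<n)

>⇒≡ᵇ-false : ∀ {m n} → n < m → (m ≡ᵇ n) ≡ false
>⇒≡ᵇ-false n<m = ≢⇒≡ᵇ-false (ℕ.>⇒≢ n<m)

k<k+suc : ∀ k m → k < k + suc m
k<k+suc k m = ℕ.m<m+n k (s≤s z≤n)

filterᵇ-∷ : ∀ {A : Set} (p : A → Bool) x xs → filterᵇ p (x ∷ xs) ≡ (if p x then x ∷ filterᵇ p xs else filterᵇ p xs)
filterᵇ-∷ p x xs with p x
... | true  = refl
... | false = refl

module _ {A : Set} (p : A → Bool) where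

  filterᵇ-++ : ∀ xs ys → filterᵇ p (xs ++ ys) ≡ filterᵇ p xs ++ filterᵇ p ys
  filterᵇ-++ [] ys = refl
  filterᵇ-++ (x ∷ xs) ys rewrite filterᵇ-∷ p x (xs ++ ys) | filterᵇ-∷ p x xs with p x
  ... | true  = cong (x ∷_) (filterᵇ-++ xs ys)
  ... | false = filterᵇ-++ xs ys

  filterᵇ-concatMap : ∀ {B : Set} (f : B → List A) xs →
    filterᵇ p (concatMap f xs) ≡ concatMap (λ x → filterᵇ p (f x)) xs
  filterᵇ-concatMap f [] = refl
  filterᵇ-concatMap f (x ∷ xs) =
    trans (filterᵇ-++ (f x) (concatMap f xs)) (cong (filterᵇ p (f x) ++_) (filterᵇ-concatMap f xs))

  filterᵇ-map : ∀ {B : Set} (f : B → A) xs → filterᵇ p (map f xs) ≡ map f (filterᵇ (λ x → p (f x)) xs)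
  filterᵇ-map f [] = refl
  filterᵇ-map f (x ∷ xs) rewrite filterᵇ-∷ p (f x) (map f xs) | filterᵇ-∷ (λ x → p (f x)) x xs with p (f x)
  ... | true  = cong (f x ∷_) (filterᵇ-map f xs)
  ... | false = filterᵇ-map f xs

  filterᵇ-cong-local : ∀ {q : A → Bool} {xs} → All (λ x → p x ≡ q x) xs → filterᵇ p xs ≡ filterᵇ q xs
  filterᵇ-cong-local {q} [] = refl
  filterᵇ-cong-local {q} {x ∷ xs} (px≡qx ∷ eqs) rewrite filterᵇ-∷ p x xs | filterᵇ-∷ q x xs | px≡qx =
    cong (λ ys → if q x then x ∷ ys else ys) (filterᵇ-cong-local eqs)

  filterᵇ-∧ˡ : ∀ c xs → filterᵇ (λ x → c ∧ p x) xs ≡ (if c then filterᵇ p xs else [])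
  filterᵇ-∧ˡ true  xs       = refl
  filterᵇ-∧ˡ false []       = refl
  filterᵇ-∧ˡ false (x ∷ xs) = filterᵇ-∧ˡ false xs

concatMap-↭ : ∀ {A B : Set} (f : A → List B) {xs ys} → xs ↭ ys → concatMap f xs ↭ concatMap f ys
concatMap-↭ f Perm.refl          = ↭-refl
concatMap-↭ f (prep x p)         = ++⁺ˡ (f x) (concatMap-↭ f p)
concatMap-↭ f (swap x y p)       = ↭-trans (shifts (f x) (f y)) (++⁺ˡ (f y) (++⁺ˡ (f x) (concatMap-↭ f p)))
concatMap-↭ f (Perm.trans p q)   = ↭-trans (concatMap-↭ f p) (concatMap-↭ f q)

concatMap-++-distrib : ∀ {A B : Set} (f g : A → List B) xs → concatMap (λ x → f x ++ g x) xs ↭ concatMap f xs ++ concatMap g xs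
concatMap-++-distrib f g []       = ↭-refl
concatMap-++-distrib f g (x ∷ xs) = begin
    (f x ++ g x) ++ concatMap (λ x → f x ++ g x) xs
  ↭⟨ ++-assoc (f x) (g x) _ ⟩
    f x ++ g x ++ concatMap (λ x → f x ++ g x) xs
  ↭⟨ ++⁺ˡ (f x) (++⁺ˡ (g x) (concatMap-++-distrib f g xs)) ⟩
    f x ++ g x ++ concatMap f xs ++ concatMap g xs
  ↭⟨ ++⁺ˡ (f x) (shifts (g x) (concatMap f xs)) ⟩
    f x ++ concatMap f xs ++ g x ++ concatMap g xs
  ↭⟨ ↭-sym (++-assoc (f x) (concatMap f xs) _) ⟩
    (f x ++ concatMap f xs) ++ g x ++ concatMap g xs
  ∎
  where open PermutationReasoning

concatUpTo : {A : Set} → (ℕ → List A) → ℕ → List A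
concatUpTo F zero    = []
concatUpTo F (suc m) = F 0 ++ concatUpTo (λ c → F (suc c)) m

module _ {A : Set} where

  concatMap-applyUpTo : ∀ {B : Set} (F : B → List A) (g : ℕ → B) m → concatMap F (applyUpTo g m) ≡ concatUpTo (λ c → F (g c)) m
  concatMap-applyUpTo F g zero    = refl
  concatMap-applyUpTo F g (suc m) = cong (F (g 0) ++_) (concatMap-applyUpTo F (λ c → g (suc c)) m)

  concatUpTo-+ : ∀ (F : ℕ → List A) m n → concatUpTo F (m + n) ≡ concatUpTo F m ++ concatUpTo (λ c → F (m + c)) n
  concatUpTo-+ F zero    n = refl
  concatUpTo-+ F (suc m) n = trans (cong (F 0 ++_) (concatUpTo-+ (λ c → F (suc c)) m n)) (sym (List.++-assoc (F 0) _ _))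

  concatUpTo-↭ : ∀ {F G : ℕ → List A} m → (∀ {c} → c < m → F c ↭ G c) → concatUpTo F m ↭ concatUpTo G m
  concatUpTo-↭ zero    F↭G = ↭-refl
  concatUpTo-↭ (suc m) F↭G = ++⁺ (F↭G (s≤s z≤n)) (concatUpTo-↭ m (λ c<m → F↭G (s≤s c<m)))

  concatUpTo-cong : ∀ {F G : ℕ → List A} m → (∀ c → F c ≡ G c) → concatUpTo F m ≡ concatUpTo G m
  concatUpTo-cong zero    F≡G = refl
  concatUpTo-cong (suc m) F≡G = cong₂ _++_ (F≡G 0) (concatUpTo-cong m (λ c → F≡G (suc c)))

  concatUpTo-[] : ∀ {F : ℕ → List A} m → (∀ {c} → c < m → F c ≡ []) → concatUpTo F m ≡ []
  concatUpTo-[] zero    F≡[] = refl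
  concatUpTo-[] (suc m) F≡[] rewrite F≡[] (s≤s z≤n) = concatUpTo-[] m (λ c<m → F≡[] (s≤s c<m))

  map-concatUpTo : ∀ {B : Set} (f : A → B) (F : ℕ → List A) m → map f (concatUpTo F m) ≡ concatUpTo (λ c → map f (F c)) m
  map-concatUpTo f F zero    = refl
  map-concatUpTo f F (suc m) = trans (List.map-++ f (F 0) _) (cong (map f (F 0) ++_) (map-concatUpTo f (λ c → F (suc c)) m))

map-concatUpTo-map : ∀ {A B C : Set} (f : B → C) (h : ℕ → A → B) (S : ℕ → List A) m →
  map f (concatUpTo (λ c → map (h c) (S c)) m) ≡ concatUpTo (λ c → map (λ u → f (h c u)) (S c)) m
map-concatUpTo-map f h S m = trans (map-concatUpTo f (λ c → map (h c) (S c)) m) (concatUpTo-cong m (λ c → sym (List.map-∘ (S c))))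

interval : ℕ → ℕ → List ℕ
interval k zero    = []
interval k (suc m) = k ∷ interval (suc k) m

interval-∷ʳ : ∀ k m → interval k (suc m) ≡ interval k m ++ [ k + m ]
interval-∷ʳ k zero    = cong [_] (sym (ℕ.+-identityʳ k))
interval-∷ʳ k (suc m) = cong (k ∷_) (trans (interval-∷ʳ (suc k) m) (cong (λ j → interval (suc k) m ++ [ j ]) (sym (ℕ.+-suc k m))))

applyUpTo-interval : ∀ (f : ℕ → ℕ) k m → (∀ i → f i ≡ k + i) → applyUpTo f m ≡ interval k m
applyUpTo-interval f k zero    fi≡k+i = refl
applyUpTo-interval f k (suc m) fi≡k+i = cong₂ _∷_ (trans (fi≡k+i 0) (ℕ.+-identityʳ k))
  (applyUpTo-interval (λ i → f (suc i)) (suc k) m (λ i → trans (fi≡k+i (suc i)) (ℕ.+-suc k i)))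

range1≡interval : ∀ m → range1 m ≡ interval 1 m
range1≡interval m = applyUpTo-interval suc 1 m (λ i → refl)

All-interval : ∀ {P : ℕ → Set} k m → (∀ {j} → k ≤ j → j < k + m → P j) → All P (interval k m)
All-interval k zero    Pj = []
All-interval k (suc m) Pj =
  Pj ℕ.≤-refl (k<k+suc k m) ∷
  All-interval (suc k) m (λ k<j j<k+m → Pj (ℕ.<⇒≤ k<j) (ℕ.≤-trans j<k+m (ℕ.≤-reflexive (sym (ℕ.+-suc k m)))))

map-const-interval : ∀ {E : Set} {f : ℕ → E} {c} k m → (∀ {j} → k ≤ j → j < k + m → f j ≡ c) →
  map f (interval k m) ≡ replicate m c
map-const-interval k zero    fj≡c = refl
map-const-interval k (suc m) fj≡c = cong₂ _∷_ (fj≡c ℕ.≤-refl (k<k+suc k m))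
  (map-const-interval (suc k) m (λ k<j j<k+m → fj≡c (ℕ.<⇒≤ k<j) (ℕ.≤-trans j<k+m (ℕ.≤-reflexive (sym (ℕ.+-suc k m))))))

headOr : {E : Set} → List E → E → E
headOr []      t = t
headOr (z ∷ _) t = z

headOr-map-interval : ∀ {E : Set} (f : ℕ → E) k m {t} → f (k + m) ≡ t → headOr (map f (interval k m)) t ≡ f k
headOr-map-interval f k zero    eq = trans (sym eq) (cong f (ℕ.+-identityʳ k))
headOr-map-interval f k (suc m) eq = refl

replicate-∷ʳ : ∀ {A : Set} (x : A) z → replicate (suc z) x ≡ replicate z x ++ [ x ]
replicate-∷ʳ x zero    = refl
replicate-∷ʳ x (suc z) = cong (x ∷_) (replicate-∷ʳ x z)

∷ʳ≢[] : ∀ (xs : Index) {x} → xs ++ [ x ] ≢ []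
∷ʳ≢[] []      ()
∷ʳ≢[] (_ ∷ _) ()

shuffles : {E : Set} → List E → List E → List (List E)
shuffles []      v       = [ v ]
shuffles (x ∷ u) []      = [ x ∷ u ]
shuffles (x ∷ u) (y ∷ v) = map (x ∷_) (shuffles u (y ∷ v)) ++ map (y ∷_) (shuffles (x ∷ u) v)

shuffles-[]ʳ : {E : Set} (u : List E) → shuffles u [] ≡ [ u ]
shuffles-[]ʳ []      = refl
shuffles-[]ʳ (x ∷ u) = refl

shuffles-comm : {E : Set} (u v : List E) → shuffles u v ↭ shuffles v u
shuffles-comm []      []      = ↭-refl
shuffles-comm []      (y ∷ v) = ↭-refl
shuffles-comm (x ∷ u) []      = ↭-refl
shuffles-comm (x ∷ u) (y ∷ v) =
  ↭-trans (++⁺ (map⁺ (x ∷_) (shuffles-comm u (y ∷ v))) (map⁺ (y ∷_) (shuffles-comm (x ∷ u) v)))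
          (++-comm (map (x ∷_) (shuffles (y ∷ v) u)) (map (y ∷_) (shuffles v (x ∷ u))))

map-shuffles : {A B : Set} (f : A → B) (u v : List A) → map (map f) (shuffles u v) ≡ shuffles (map f u) (map f v)
map-shuffles f []      v       = refl
map-shuffles f (x ∷ u) []      = refl
map-shuffles f (x ∷ u) (y ∷ v) = begin
    map (map f) (map (x ∷_) (shuffles u (y ∷ v)) ++ map (y ∷_) (shuffles (x ∷ u) v))
  ≡⟨ List.map-++ (map f) (map (x ∷_) (shuffles u (y ∷ v))) _ ⟩
    map (map f) (map (x ∷_) (shuffles u (y ∷ v))) ++ map (map f) (map (y ∷_) (shuffles (x ∷ u) v))
  ≡⟨ cong₂ _++_ (trans (sym (List.map-∘ (shuffles u (y ∷ v)))) (List.map-∘ (shuffles u (y ∷ v))))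
                (trans (sym (List.map-∘ (shuffles (x ∷ u) v))) (List.map-∘ (shuffles (x ∷ u) v))) ⟩
    map (f x ∷_) (map (map f) (shuffles u (y ∷ v))) ++ map (f y ∷_) (map (map f) (shuffles (x ∷ u) v))
  ≡⟨ cong₂ (λ l r → map (f x ∷_) l ++ map (f y ∷_) r) (map-shuffles f u (y ∷ v)) (map-shuffles f (x ∷ u) v) ⟩
    shuffles (map f (x ∷ u)) (map f (y ∷ v))
  ∎
  where open ≡-Reasoning

All-shuffles : {E : Set} {P : E → Set} {u v : List E} → All P u → All P v → All (All P) (shuffles u v)
All-shuffles {u = []}    {v}     pu pv = pv ∷ []
All-shuffles {u = _ ∷ _} {[]}    pu pv = pu ∷ []
All-shuffles {u = _ ∷ _} {_ ∷ _} (px ∷ pu) (py ∷ pv) =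
  All.++⁺ (All.map⁺ (All.map (px ∷_) (All-shuffles pu (py ∷ pv))))
          (All.map⁺ (All.map (py ∷_) (All-shuffles (px ∷ pu) pv)))

-- Sorting the shuffles by the number c of leading x's before the first y.
shuffles-replicate-∷ : ∀ {E : Set} (x y : E) v z →
  shuffles (replicate z x) (y ∷ v)
    ↭ concatUpTo (λ c → map (λ u → replicate c x ++ y ∷ u) (shuffles (replicate (z ∸ c) x) v)) (suc z)
shuffles-replicate-∷ x y v zero    = ↭-refl
shuffles-replicate-∷ x y v (suc z) = begin
    map (x ∷_) (shuffles (replicate z x) (y ∷ v)) ++ map (y ∷_) (shuffles (replicate (suc z) x) v)
  ↭⟨ ++-comm (map (x ∷_) (shuffles (replicate z x) (y ∷ v))) _ ⟩
    map (y ∷_) (shuffles (replicate (suc z) x) v) ++ map (x ∷_) (shuffles (replicate z x) (y ∷ v))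
  ↭⟨ ++⁺ˡ (map (y ∷_) (shuffles (replicate (suc z) x) v)) (map⁺ (x ∷_) (shuffles-replicate-∷ x y v z)) ⟩
    map (y ∷_) (shuffles (replicate (suc z) x) v) ++ map (x ∷_) (concatUpTo F (suc z))
  ≡⟨ cong (map (y ∷_) (shuffles (replicate (suc z) x) v) ++_)
          (map-concatUpTo-map (x ∷_) (λ c u → replicate c x ++ y ∷ u) (λ c → shuffles (replicate (z ∸ c) x) v) (suc z)) ⟩
    concatUpTo (λ c → map (λ u → replicate c x ++ y ∷ u) (shuffles (replicate (suc z ∸ c) x) v)) (suc (suc z))
  ∎
  where
  open PermutationReasoning
  F : ℕ → List (List _)
  F c = map (λ u → replicate c x ++ y ∷ u) (shuffles (replicate (z ∸ c) x) v)

module Extensions {E : Set} (g : E → E → Bool) where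

  extensions : List E → List (List E)
  extensions xs = filterᵇ (respects g) (perms xs)

  _≮_ : E → E → Set
  x ≮ y = g x y ≡ false

  insertRespecting : E → List E → List (List E)
  insertRespecting x []      = [ [ x ] ]
  insertRespecting x (y ∷ σ) = (if not (any (λ z → g z x) (y ∷ σ)) then [ x ∷ y ∷ σ ] else [])
                            ++ (if not (g x y) then map (y ∷_) (insertRespecting x σ) else [])

  any-insertions : ∀ (h : E → Bool) x σ → All (λ τ → any h τ ≡ (h x ∨ any h σ)) (insertions x σ)
  any-insertions h x []      = refl ∷ []
  any-insertions h x (y ∷ σ) = refl ∷ All.map⁺ (All.map (λ eq → trans (cong (h y ∨_) eq) (∨-leftComm (h y) (h x) _))
                                                       (any-insertions h x σ))
    where
    ∨-leftComm : ∀ u v w → u ∨ (v ∨ w) ≡ v ∨ (u ∨ w)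
    ∨-leftComm false v     w = refl
    ∨-leftComm true  false w = refl
    ∨-leftComm true  true  w = refl

  private
    if-insertion : ∀ (A S B G : Bool) (w : List E) (y : E) (τs : List (List E)) →
      (if B ∧ (not A ∧ S) then w ∷ map (y ∷_) (if not (G ∨ A) then (if S then τs else []) else [])
                         else map (y ∷_) (if not (G ∨ A) then (if S then τs else []) else []))
      ≡ (if not A ∧ S then (if B then [ w ] else []) ++ (if not G then map (y ∷_) τs else []) else [])
    if-insertion true  true  true  true  w y τs = refl
    if-insertion true  true  true  false w y τs = refl
    if-insertion true  true  false true  w y τs = refl
    if-insertion true  true  false false w y τs = refl
    if-insertion true  false true  true  w y τs = refl
    if-insertion true  false true  false w y τs = refl
    if-insertion true  false false true  w y τs = refl
    if-insertion true  false false false w y τs = refl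
    if-insertion false true  true  true  w y τs = refl
    if-insertion false true  true  false w y τs = refl
    if-insertion false true  false true  w y τs = refl
    if-insertion false true  false false w y τs = refl
    if-insertion false false true  true  w y τs = refl
    if-insertion false false true  false w y τs = refl
    if-insertion false false false true  w y τs = refl
    if-insertion false false false false w y τs = refl

  respecting-insertions : ∀ x σ →
    filterᵇ (respects g) (insertions x σ) ≡ (if respects g σ then insertRespecting x σ else [])
  respecting-insertions x []      = refl
  respecting-insertions x (y ∷ σ) = begin
      filterᵇ (respects g) ((x ∷ y ∷ σ) ∷ map (y ∷_) (insertions x σ))
    ≡⟨ filterᵇ-∷ (respects g) (x ∷ y ∷ σ) _ ⟩
      (if respects g (x ∷ y ∷ σ) then (x ∷ y ∷ σ) ∷ later else later)
    ≡⟨ cong (λ ys → if respects g (x ∷ y ∷ σ) then (x ∷ y ∷ σ) ∷ ys else ys)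
            (trans (filterᵇ-map (respects g) (y ∷_) (insertions x σ)) (cong (map (y ∷_)) later≡)) ⟩
      _
    ≡⟨ if-insertion (any (λ z → g z y) σ) (respects g σ) (not (any (λ z → g z x) (y ∷ σ))) (g x y)
                    (x ∷ y ∷ σ) y (insertRespecting x σ) ⟩
      _
    ∎
    where
    open ≡-Reasoning
    later = filterᵇ (respects g) (map (y ∷_) (insertions x σ))
    c = not (g x y ∨ any (λ z → g z y) σ)
    later≡ : filterᵇ (λ τ → respects g (y ∷ τ)) (insertions x σ)
           ≡ (if c then (if respects g σ then insertRespecting x σ else []) else [])
    later≡ = begin
        filterᵇ (λ τ → respects g (y ∷ τ)) (insertions x σ)
      ≡⟨ filterᵇ-cong-local _ (All.map (λ {τ} → cong (λ u → not u ∧ respects g τ)) (any-insertions (λ z → g z y) x σ)) ⟩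
        filterᵇ (λ τ → c ∧ respects g τ) (insertions x σ)
      ≡⟨ filterᵇ-∧ˡ (respects g) c (insertions x σ) ⟩
        (if c then filterᵇ (respects g) (insertions x σ) else [])
      ≡⟨ cong (λ ys → if c then ys else []) (respecting-insertions x σ) ⟩
        (if c then (if respects g σ then insertRespecting x σ else []) else [])
      ∎

  extensions-∷ : ∀ x xs → extensions (x ∷ xs) ≡ concatMap (insertRespecting x) (extensions xs)
  extensions-∷ x xs = begin
      filterᵇ (respects g) (concatMap (insertions x) (perms xs))
    ≡⟨ filterᵇ-concatMap (respects g) (insertions x) (perms xs) ⟩
      concatMap (λ σ → filterᵇ (respects g) (insertions x σ)) (perms xs)
    ≡⟨ List.concatMap-cong (respecting-insertions x) (perms xs) ⟩
      concatMap (λ σ → if respects g σ then insertRespecting x σ else []) (perms xs)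
    ≡⟨ concatMap-if (perms xs) ⟩
      concatMap (insertRespecting x) (extensions xs)
    ∎
    where
    open ≡-Reasoning
    concatMap-if : ∀ σs → concatMap (λ σ → if respects g σ then insertRespecting x σ else []) σs
                        ≡ concatMap (insertRespecting x) (filterᵇ (respects g) σs)
    concatMap-if []       = refl
    concatMap-if (σ ∷ σs) rewrite filterᵇ-∷ (respects g) σ σs with respects g σ
    ... | true  = cong (insertRespecting x σ ++_) (concatMap-if σs)
    ... | false = concatMap-if σs

  -- When nothing in τ lies below x, x can only be stopped by an element above it.
  insertUpward : E → List E → List (List E)
  insertUpward x []      = [ [ x ] ]
  insertUpward x (y ∷ τ) = (x ∷ y ∷ τ) ∷ (if g x y then [] else map (y ∷_) (insertUpward x τ))

  any-below-false : ∀ {x τ} → All (_≮ x) τ → any (λ z → g z x) τ ≡ false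
  any-below-false []           = refl
  any-below-false (z≮x ∷ τ≮x) rewrite z≮x = any-below-false τ≮x

  insertRespecting≡insertUpward : ∀ {x τ} → All (_≮ x) τ → insertRespecting x τ ≡ insertUpward x τ
  insertRespecting≡insertUpward []                                = refl
  insertRespecting≡insertUpward {x} {y ∷ τ} (y≮x ∷ τ≮x)
    rewrite any-below-false τ≮x | y≮x | insertRespecting≡insertUpward τ≮x with g x y
  ... | true  = refl
  ... | false = refl

  module _ {x t : E} where

    private
      insertInto : List E → List (List E)
      insertInto σ = insertUpward x (σ ++ [ t ])

      map-∷-++ : ∀ y σs → map (y ∷_) (map (_++ [ t ]) σs) ≡ map (_++ [ t ]) (map (y ∷_) σs)
      map-∷-++ y σs = trans (sym (List.map-∘ σs)) (List.map-∘ σs)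

      insertInto-above : ∀ {z} → g x z ≡ true → ∀ σs →
        concatMap insertInto (map (z ∷_) σs) ≡ map (λ σ → x ∷ z ∷ σ ++ [ t ]) σs
      insertInto-above x<z []       = refl
      insertInto-above x<z (σ ∷ σs) rewrite x<z = cong (_ ∷_) (insertInto-above x<z σs)

      insertInto-incomparable : ∀ {y} → x ≮ y → ∀ σs →
        concatMap insertInto (map (y ∷_) σs) ↭ map (λ σ → x ∷ y ∷ σ ++ [ t ]) σs ++ map (y ∷_) (concatMap insertInto σs)
      insertInto-incomparable x≮y [] = ↭-refl
      insertInto-incomparable {y} x≮y (σ ∷ σs) rewrite x≮y = prep _ (begin
          map (y ∷_) (insertInto σ) ++ concatMap insertInto (map (y ∷_) σs)
        ↭⟨ ++⁺ˡ (map (y ∷_) (insertInto σ)) (insertInto-incomparable x≮y σs) ⟩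
          map (y ∷_) (insertInto σ) ++ map (λ σ → x ∷ y ∷ σ ++ [ t ]) σs ++ map (y ∷_) (concatMap insertInto σs)
        ↭⟨ shifts (map (y ∷_) (insertInto σ)) (map (λ σ → x ∷ y ∷ σ ++ [ t ]) σs) ⟩
          map (λ σ → x ∷ y ∷ σ ++ [ t ]) σs ++ map (y ∷_) (insertInto σ) ++ map (y ∷_) (concatMap insertInto σs)
        ≡⟨ cong (map (λ σ → x ∷ y ∷ σ ++ [ t ]) σs ++_) (sym (List.map-++ (y ∷_) (insertInto σ) (concatMap insertInto σs))) ⟩
          map (λ σ → x ∷ y ∷ σ ++ [ t ]) σs ++ map (y ∷_) (insertInto σ ++ concatMap insertInto σs)
        ∎)
        where open PermutationReasoning

      map-∷∷-++ : ∀ w σs → map (_++ [ t ]) (map (x ∷_) (map (w ∷_) σs)) ≡ map (λ σ → x ∷ w ∷ σ ++ [ t ]) σs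
      map-∷∷-++ w σs = trans (sym (List.map-∘ (map (w ∷_) σs))) (sym (List.map-∘ σs))

      map-++-shuffles-∷∷ : ∀ z u y c2 →
        map (_++ [ t ]) (shuffles (x ∷ z ∷ u) (y ∷ c2))
          ≡ map (λ σ → x ∷ z ∷ σ ++ [ t ]) (shuffles u (y ∷ c2)) ++ map (λ σ → x ∷ y ∷ σ ++ [ t ]) (shuffles (z ∷ u) c2)
            ++ map (y ∷_) (map (_++ [ t ]) (shuffles (x ∷ z ∷ u) c2))
      map-++-shuffles-∷∷ z u y c2 = begin
          map (_++ [ t ]) (map (x ∷_) (map (z ∷_) A ++ map (y ∷_) B) ++ map (y ∷_) S)
        ≡⟨ List.map-++ (_++ [ t ]) (map (x ∷_) (map (z ∷_) A ++ map (y ∷_) B)) _ ⟩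
          map (_++ [ t ]) (map (x ∷_) (map (z ∷_) A ++ map (y ∷_) B)) ++ map (_++ [ t ]) (map (y ∷_) S)
        ≡⟨ cong₂ _++_ (trans (cong (map (_++ [ t ])) (List.map-++ (x ∷_) (map (z ∷_) A) _))
                             (List.map-++ (_++ [ t ]) (map (x ∷_) (map (z ∷_) A)) _))
                      (sym (map-∷-++ y S)) ⟩
          (map (_++ [ t ]) (map (x ∷_) (map (z ∷_) A)) ++ map (_++ [ t ]) (map (x ∷_) (map (y ∷_) B)))
            ++ map (y ∷_) (map (_++ [ t ]) S)
        ≡⟨ List.++-assoc (map (_++ [ t ]) (map (x ∷_) (map (z ∷_) A))) _ _ ⟩
          map (_++ [ t ]) (map (x ∷_) (map (z ∷_) A)) ++ map (_++ [ t ]) (map (x ∷_) (map (y ∷_) B))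
            ++ map (y ∷_) (map (_++ [ t ]) S)
        ≡⟨ cong₂ (λ l r → l ++ r ++ map (y ∷_) (map (_++ [ t ]) S)) (map-∷∷-++ z A) (map-∷∷-++ y B) ⟩
          map (λ σ → x ∷ z ∷ σ ++ [ t ]) A ++ map (λ σ → x ∷ y ∷ σ ++ [ t ]) B ++ map (y ∷_) (map (_++ [ t ]) S)
        ∎
        where
        open ≡-Reasoning
        A = shuffles u (y ∷ c2)
        B = shuffles (z ∷ u) c2
        S = shuffles (x ∷ z ∷ u) c2

    insertUpward-shuffles : ∀ c1 c2 → All (x ≮_) c2 → g x (headOr c1 t) ≡ true →
      concatMap insertInto (shuffles c1 c2) ↭ map (_++ [ t ]) (shuffles (x ∷ c1) c2)
    insertUpward-shuffles []      []       _ x<t rewrite x<t = ↭-refl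
    insertUpward-shuffles (z ∷ u) []       _ x<z rewrite x<z = ↭-refl
    insertUpward-shuffles []      (y ∷ c2) (x≮y ∷ x≮c2) x<t = begin
        concatMap insertInto (map (y ∷_) [ c2 ])
      ↭⟨ insertInto-incomparable x≮y [ c2 ] ⟩
        (x ∷ y ∷ c2 ++ [ t ]) ∷ map (y ∷_) (concatMap insertInto (shuffles [] c2))
      ↭⟨ prep _ (map⁺ (y ∷_) (insertUpward-shuffles [] c2 x≮c2 x<t)) ⟩
        (x ∷ y ∷ c2 ++ [ t ]) ∷ map (y ∷_) (map (_++ [ t ]) (shuffles [ x ] c2))
      ≡⟨ cong ((x ∷ y ∷ c2 ++ [ t ]) ∷_) (map-∷-++ y (shuffles [ x ] c2)) ⟩
        map (_++ [ t ]) (shuffles [ x ] (y ∷ c2))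
      ∎
      where open PermutationReasoning
    insertUpward-shuffles (z ∷ u) (y ∷ c2) (x≮y ∷ x≮c2) x<z = begin
        concatMap insertInto (map (z ∷_) A ++ map (y ∷_) B)
      ≡⟨ List.concatMap-++ insertInto (map (z ∷_) A) (map (y ∷_) B) ⟩
        concatMap insertInto (map (z ∷_) A) ++ concatMap insertInto (map (y ∷_) B)
      ↭⟨ ++⁺ (↭-reflexive (insertInto-above x<z A)) (insertInto-incomparable x≮y B) ⟩
        map (λ σ → x ∷ z ∷ σ ++ [ t ]) A ++ map (λ σ → x ∷ y ∷ σ ++ [ t ]) B ++ map (y ∷_) (concatMap insertInto B)
      ↭⟨ ++⁺ˡ (map (λ σ → x ∷ z ∷ σ ++ [ t ]) A) (++⁺ˡ (map (λ σ → x ∷ y ∷ σ ++ [ t ]) B)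
             (map⁺ (y ∷_) (insertUpward-shuffles (z ∷ u) c2 x≮c2 x<z))) ⟩
        map (λ σ → x ∷ z ∷ σ ++ [ t ]) A ++ map (λ σ → x ∷ y ∷ σ ++ [ t ]) B
          ++ map (y ∷_) (map (_++ [ t ]) (shuffles (x ∷ z ∷ u) c2))
      ≡⟨ sym (map-++-shuffles-∷∷ z u y c2) ⟩
        map (_++ [ t ]) (shuffles (x ∷ z ∷ u) (y ∷ c2))
      ∎
      where
      open PermutationReasoning
      A = shuffles u (y ∷ c2)
      B = shuffles (z ∷ u) c2

  extensions-∷-shuffleˡ : ∀ x xs {c1 c2 t} → extensions xs ↭ map (_++ [ t ]) (shuffles c1 c2) →
    All (_≮ x) c1 → All (_≮ x) c2 → t ≮ x → All (x ≮_) c2 → g x (headOr c1 t) ≡ true →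
    extensions (x ∷ xs) ↭ map (_++ [ t ]) (shuffles (x ∷ c1) c2)
  extensions-∷-shuffleˡ x xs {c1} {c2} {t} ext c1≮x c2≮x t≮x x≮c2 x<c1 = begin
      extensions (x ∷ xs)
    ≡⟨ extensions-∷ x xs ⟩
      concatMap (insertRespecting x) (extensions xs)
    ↭⟨ concatMap-↭ (insertRespecting x) ext ⟩
      concatMap (insertRespecting x) (map (_++ [ t ]) (shuffles c1 c2))
    ≡⟨ List.concatMap-map (insertRespecting x) (_++ [ t ]) (shuffles c1 c2) ⟩
      concatMap (λ σ → insertRespecting x (σ ++ [ t ])) (shuffles c1 c2)
    ≡⟨ cong concat (List.map-cong-local (All.map (λ σ≮x → insertRespecting≡insertUpward (All.++⁺ σ≮x (t≮x ∷ [])))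
                                                 (All-shuffles c1≮x c2≮x))) ⟩
      concatMap (λ σ → insertUpward x (σ ++ [ t ])) (shuffles c1 c2)
    ↭⟨ insertUpward-shuffles c1 c2 x≮c2 x<c1 ⟩
      map (_++ [ t ]) (shuffles (x ∷ c1) c2)
    ∎
    where open PermutationReasoning

  extensions-∷-shuffleʳ : ∀ x xs {c1 c2 t} → extensions xs ↭ map (_++ [ t ]) (shuffles c1 c2) →
    All (_≮ x) c1 → All (_≮ x) c2 → t ≮ x → All (x ≮_) c1 → g x (headOr c2 t) ≡ true →
    extensions (x ∷ xs) ↭ map (_++ [ t ]) (shuffles c1 (x ∷ c2))
  extensions-∷-shuffleʳ x xs {c1} {c2} ext c1≮x c2≮x t≮x x≮c1 x<c2 =
    ↭-trans (extensions-∷-shuffleˡ x xs (↭-trans ext (map⁺ _ (shuffles-comm c1 c2))) c2≮x c1≮x t≮x x≮c1 x<c2)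
            (map⁺ _ (shuffles-comm (x ∷ c2) c1))

ones : ℕ → List ℕ
ones m = replicate m 1

sum-ones : ∀ m → sum (ones m) ≡ m
sum-ones zero    = refl
sum-ones (suc m) = cong suc (sum-ones m)

length-ones-∷ʳ : ∀ p n → length (ones p ++ [ n ]) ≡ suc p
length-ones-∷ʳ zero    n = refl
length-ones-∷ʳ (suc p) n = cong suc (length-ones-∷ʳ p n)

nth1-ones-∷ʳ : ∀ p n {j} → 1 ≤ j → j ≤ p → nth1 (ones p ++ [ n ]) j ≡ 1
nth1-ones-∷ʳ (suc p) n {suc zero}    _ _           = refl
nth1-ones-∷ʳ (suc p) n {suc (suc j)} _ (s≤s j≤p) = nth1-ones-∷ʳ p n (s≤s z≤n) j≤p

nth1-ones-∷ʳ-last : ∀ p n → nth1 (ones p ++ [ n ]) (suc p) ≡ n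
nth1-ones-∷ʳ-last zero          n = refl
nth1-ones-∷ʳ-last (suc zero)    n = refl
nth1-ones-∷ʳ-last (suc (suc p)) n = nth1-ones-∷ʳ-last (suc p) n

any-starts-ones : ∀ r {j} → 1 ≤ j → j ≤ r → any (j ≡ᵇ_) (starts (ones r)) ≡ true
any-starts-ones (suc r) {suc zero}    _ _           = refl
any-starts-ones (suc r) {suc (suc j)} _ (s≤s j≤r) =
  trans (cong or (sym (List.map-∘ (starts (ones r))))) (any-starts-ones r (s≤s z≤n) j≤r)

-- The chains As ++ Cs = a₁ < ⋯ < a_r < b_{s,1} < ⋯ < b_{s,n-1} and Bs = b_{1,1} < ⋯ < b_{p,1} lie below
-- top = b_{s,n} and exhaust Q, so the linear extensions are the shuffles of the two chains followed by top.
module OnesPoset (r′ p n′ : ℕ) where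

  r s n : ℕ
  r = suc r′
  s = suc p
  n = suc n′

  𝐤 𝐥 : Index
  𝐤 = ones r
  𝐥 = ones p ++ [ n ]

  open TwoPoset (Q 𝐤 𝐥) using (gen; elems; label)
  open Extensions gen

  As Bs Cs : List QElem
  As = map a (interval 1 r)
  Bs = map (λ j → b j 1) (interval 1 p)
  Cs = map (b s) (interval 1 n′)

  top : QElem
  top = b s n

  elems≡ : elems ≡ As ++ Bs ++ Cs ++ [ top ]
  elems≡ = cong₂ _++_ (cong (map a) (trans (cong range1 (sum-ones r)) (range1≡interval r))) (begin
      concatMap column (range1 (length 𝐥))
    ≡⟨ cong (concatMap column) (trans (cong range1 (length-ones-∷ʳ p n)) (trans (range1≡interval s) (interval-∷ʳ 1 p))) ⟩
      concatMap column (interval 1 p ++ [ s ])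
    ≡⟨ List.concatMap-++ column (interval 1 p) [ s ] ⟩
      concatMap column (interval 1 p) ++ column s ++ []
    ≡⟨ cong₂ _++_ short-columns (trans (List.++-identityʳ (column s)) last-column) ⟩
      Bs ++ Cs ++ [ top ]
    ∎)
    where
    open ≡-Reasoning
    column : ℕ → List QElem
    column j = map (b j) (range1 (nth1 𝐥 j))
    short-columns : concatMap column (interval 1 p) ≡ Bs
    short-columns = begin
        concatMap column (interval 1 p)
      ≡⟨ cong concat (List.map-cong-local (All-interval 1 p (λ 1≤j j<1+p →
           cong (λ i → map (b _) (range1 i)) (nth1-ones-∷ʳ p n 1≤j (ℕ.≤-pred j<1+p))))) ⟩
        concat (map (λ j → [ b j 1 ]) (interval 1 p))
      ≡⟨ cong concat (List.map-∘ (interval 1 p)) ⟩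
        concat (map [_] Bs)
      ≡⟨ List.concat-map-[ Bs ] ⟩
        Bs
      ∎
    last-column : column s ≡ Cs ++ [ top ]
    last-column = begin
        map (b s) (range1 (nth1 𝐥 s))
      ≡⟨ cong (map (b s)) (trans (cong range1 (nth1-ones-∷ʳ-last p n)) (trans (range1≡interval n) (interval-∷ʳ 1 n′))) ⟩
        map (b s) (interval 1 n′ ++ [ n ])
      ≡⟨ List.map-++ (b s) (interval 1 n′) [ n ] ⟩
        Cs ++ [ top ]
      ∎

  a-step : ∀ j → gen (a j) (a (suc j)) ≡ true
  a-step j = ≡ᵇ-refl (suc j)

  a-top : gen (a r) (b s 1) ≡ true
  a-top = ∧-true (trans (cong (r ≡ᵇ_) (sum-ones r)) (≡ᵇ-refl r))
                 (∧-true (trans (cong (s ≡ᵇ_) (length-ones-∷ʳ p n)) (≡ᵇ-refl s)) refl)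

  b-step : ∀ j i → gen (b j i) (b j (suc i)) ≡ true
  b-step j i = ∨-trueˡ (∧-true (≡ᵇ-refl j) (≡ᵇ-refl i))

  b-next : ∀ j → gen (b j 1) (b (suc j) (nth1 𝐥 (suc j))) ≡ true
  b-next j = ∨-trueʳ (∧-true (≡ᵇ-refl j) (≡ᵇ-refl (nth1 𝐥 (suc j))))

  later-a≮a : ∀ {j j′} → j < j′ → a j′ ≮ a j
  later-a≮a j<j′ = <⇒≡ᵇ-false (ℕ.m<n⇒m<1+n j<j′)

  later-b≮b : ∀ {j j′} i i′ → j < j′ → b j′ i′ ≮ b j i
  later-b≮b i i′ j<j′ = ∨-false (∧-falseˡ (<⇒≡ᵇ-false j<j′)) (∧-falseˡ (<⇒≡ᵇ-false (ℕ.m<n⇒m<1+n j<j′)))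

  higher-b≮b : ∀ j {i i′} → i < i′ → b j i′ ≮ b j i
  higher-b≮b j i<i′ = ∨-false (∧-falseʳ (<⇒≡ᵇ-false (ℕ.m<n⇒m<1+n i<i′))) (∧-falseˡ (<⇒≡ᵇ-false (ℕ.n<1+n j)))

  a≮b : ∀ j {j′} i → j′ < s → a j ≮ b j′ i
  a≮b j {j′} i j′<s =
    ∧-falseʳ {j ≡ᵇ sum 𝐤} (∧-falseˡ {y = i ≡ᵇ 1} (trans (cong (j′ ≡ᵇ_) (length-ones-∷ʳ p n)) (<⇒≡ᵇ-false j′<s)))

  b≮top-chain : ∀ {j i} → j < s → i < n → b j 1 ≮ b s i
  b≮top-chain {i = i} j<s i<n =
    ∨-false (∧-falseˡ (>⇒≡ᵇ-false j<s)) (∧-falseʳ (trans (cong (i ≡ᵇ_) (nth1-ones-∷ʳ-last p n)) (<⇒≡ᵇ-false i<n)))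

  extensions-Cs : ∀ m k → k + m ≡ n →
    extensions (map (b s) (interval k m) ++ [ top ]) ↭ map (_++ [ top ]) (shuffles (map (b s) (interval k m)) [])
  extensions-Cs zero    k _      = ↭-refl
  extensions-Cs (suc m) k k+m≡n  =
    extensions-∷-shuffleˡ (b s k) (map (b s) (interval (suc k) m) ++ [ top ]) (extensions-Cs m (suc k) k+1+m≡n)
    (All.map⁺ (All-interval (suc k) m (λ k<j _ → higher-b≮b s k<j)))
    []
    (higher-b≮b s (subst (k <_) k+m≡n (k<k+suc k m)))
    []
    (subst (λ y → gen (b s k) y ≡ true) (sym (headOr-map-interval (b s) (suc k) m (cong (b s) k+1+m≡n))) (b-step s k))
    where
    k+1+m≡n : suc k + m ≡ n
    k+1+m≡n = trans (sym (ℕ.+-suc k m)) k+m≡n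

  extensions-Bs : ∀ m k → k + m ≡ s →
    extensions (map (λ j → b j 1) (interval k m) ++ Cs ++ [ top ])
      ↭ map (_++ [ top ]) (shuffles Cs (map (λ j → b j 1) (interval k m)))
  extensions-Bs zero    k _      = extensions-Cs n′ 1 refl
  extensions-Bs (suc m) k k+m≡s =
    extensions-∷-shuffleʳ (b k 1) (map (λ j → b j 1) (interval (suc k) m) ++ Cs ++ [ top ]) (extensions-Bs m (suc k) k+1+m≡s)
    (All.map⁺ (All-interval 1 n′ (λ {i} _ _ → later-b≮b 1 i k<s)))
    (All.map⁺ (All-interval (suc k) m (λ k<j _ → later-b≮b 1 1 k<j)))
    (later-b≮b 1 n k<s)
    (All.map⁺ (All-interval 1 n′ (λ _ i<n → b≮top-chain k<s i<n)))
    (subst (λ y → gen (b k 1) y ≡ true) (sym (next m k+1+m≡s)) (b-next k))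
    where
    k<s : k < s
    k<s = subst (k <_) k+m≡s (k<k+suc k m)
    k+1+m≡s : suc k + m ≡ s
    k+1+m≡s = trans (sym (ℕ.+-suc k m)) k+m≡s
    next : ∀ m → suc k + m ≡ s → headOr (map (λ j → b j 1) (interval (suc k) m)) top ≡ b (suc k) (nth1 𝐥 (suc k))
    next zero    k+1≡s   = sym (trans (cong (λ j → b j (nth1 𝐥 j)) (trans (sym (ℕ.+-identityʳ (suc k))) k+1≡s))
                                      (cong (b s) (nth1-ones-∷ʳ-last p n)))
    next (suc m) k+2+m≡s = cong (b (suc k)) (sym (nth1-ones-∷ʳ p n (s≤s z≤n)
                             (subst (suc k ≤_) (ℕ.suc-injective k+2+m≡s) (k<k+suc k m))))

  extensions-As : ∀ m k → k + m ≡ suc r →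
    extensions (map a (interval k m) ++ Bs ++ Cs ++ [ top ])
      ↭ map (_++ [ top ]) (shuffles (map a (interval k m) ++ Cs) Bs)
  extensions-As zero    k _        = extensions-Bs p 1 refl
  extensions-As (suc m) k k+m≡1+r =
    extensions-∷-shuffleˡ (a k) (map a (interval (suc k) m) ++ Bs ++ Cs ++ [ top ]) (extensions-As m (suc k) k+1+m≡1+r)
    (All.++⁺ (All.map⁺ (All-interval (suc k) m (λ k<j _ → later-a≮a k<j))) Cs≮a)
    Bs≮a
    refl
    (All.map⁺ (All-interval 1 p (λ _ j<s → a≮b k 1 j<s)))
    (next m k+1+m≡1+r)
    where
    k+1+m≡1+r : suc k + m ≡ suc r
    k+1+m≡1+r = trans (sym (ℕ.+-suc k m)) k+m≡1+r
    Cs≮a : All (_≮ a k) Cs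
    Cs≮a = All.map⁺ (All.universal (λ _ → refl) (interval 1 n′))
    Bs≮a : All (_≮ a k) Bs
    Bs≮a = All.map⁺ (All.universal (λ _ → refl) (interval 1 p))
    next : ∀ m → suc k + m ≡ suc r → gen (a k) (headOr (map a (interval (suc k) m) ++ Cs) top) ≡ true
    next zero    k+1≡1+r = subst (λ y → gen (a k) y ≡ true) (sym (headOr-map-interval (b s) 1 n′ refl))
                             (subst (λ j → gen (a j) (b s 1) ≡ true)
                                    (sym (trans (sym (ℕ.+-identityʳ k)) (ℕ.suc-injective k+1≡1+r))) a-top)
    next (suc m) _       = a-step k

  extensions-Q : extensions elems ↭ map (_++ [ top ]) (shuffles (As ++ Cs) Bs)
  extensions-Q = subst (λ xs → extensions xs ↭ map (_++ [ top ]) (shuffles (As ++ Cs) Bs)) (sym elems≡)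
                       (extensions-As r 1 refl)

  ≡ᵇ-length-𝐥-false : ∀ {j} → j < s → (j ≡ᵇ length 𝐥) ≡ false
  ≡ᵇ-length-𝐥-false {j} j<s = trans (cong (j ≡ᵇ_) (length-ones-∷ʳ p n)) (<⇒≡ᵇ-false j<s)

  label-top-chain : ∀ i → label (b s i) ≡ e₀
  label-top-chain i = cong (λ c → if c then e₁ else e₀)
    (∧-falseʳ {i ≡ᵇ 1} (cong not (trans (cong (s ≡ᵇ_) (length-ones-∷ʳ p n)) (≡ᵇ-refl s))))

  label-As : map label As ≡ replicate r e₁
  label-As = trans (sym (List.map-∘ (interval 1 r))) (map-const-interval 1 r (λ 1≤j j<1+r →
    cong (λ c → if c then e₁ else e₀) (any-starts-ones r 1≤j (ℕ.≤-pred j<1+r))))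

  label-Bs : map label Bs ≡ replicate p e₁
  label-Bs = trans (sym (List.map-∘ (interval 1 p))) (map-const-interval 1 p (λ _ j<s →
    cong (λ c → if not c then e₁ else e₀) (≡ᵇ-length-𝐥-false j<s)))

  label-Cs : map label Cs ≡ replicate n′ e₀
  label-Cs = trans (sym (List.map-∘ (interval 1 n′))) (map-const-interval 1 n′ (λ {i} _ _ → label-top-chain i))

  μ-ones : μ 𝐤 𝐥 ↭ map (_++ [ e₀ ]) (shuffles (replicate r e₁ ++ replicate n′ e₀) (replicate p e₁))
  μ-ones = ↭-trans (map⁺ (map label) extensions-Q) (↭-reflexive (begin
      map (map label) (map (_++ [ top ]) S)
    ≡⟨ sym (List.map-∘ S) ⟩
      map (λ σ → map label (σ ++ [ top ])) S
    ≡⟨ List.map-cong (λ σ → trans (List.map-++ label σ [ top ]) (cong (λ e → map label σ ++ [ e ]) (label-top-chain n))) S ⟩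
      map (λ σ → map label σ ++ [ e₀ ]) S
    ≡⟨ List.map-∘ S ⟩
      map (_++ [ e₀ ]) (map (map label) S)
    ≡⟨ cong (map (_++ [ e₀ ])) (trans (map-shuffles label (As ++ Cs) Bs)
         (cong₂ shuffles (trans (List.map-++ label As Cs) (cong₂ _++_ label-As label-Cs)) label-Bs)) ⟩
      map (_++ [ e₀ ]) (shuffles (replicate r e₁ ++ replicate n′ e₀) (replicate p e₁))
    ∎))
    where
    open ≡-Reasoning
    S = shuffles (As ++ Cs) Bs

module WordSide (n′ : ℕ) where

  wordTerms : ℕ → ℕ → List Word
  wordTerms r p = map (λ u → e₁ ∷ u ++ [ e₀ ]) (shuffles (replicate r e₁ ++ replicate n′ e₀) (replicate p e₁))

  μ-recurrence : ∀ r p → μ (ones (suc r)) (ones (suc p) ++ [ suc n′ ]) ↭ wordTerms r (suc p) ++ wordTerms (suc r) p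
  μ-recurrence r p = ↭-trans (OnesPoset.μ-ones r (suc p) n′) (↭-reflexive
    (trans (List.map-++ (_++ [ e₀ ]) (map (e₁ ∷_) A) (map (e₁ ∷_) B)) (cong₂ _++_ (sym (List.map-∘ A)) (sym (List.map-∘ B)))))
    where
    A = shuffles (replicate r e₁ ++ replicate n′ e₀) (replicate (suc p) e₁)
    B = shuffles (replicate (suc r) e₁ ++ replicate n′ e₀) (replicate p e₁)

  μ-base : ∀ r → μ (ones (suc r)) (ones 0 ++ [ suc n′ ]) ↭ wordTerms r 0
  μ-base r = ↭-trans (OnesPoset.μ-ones r 0 n′)
    (↭-reflexive (cong (map (λ u → e₁ ∷ u ++ [ e₀ ])) (sym (shuffles-[]ʳ (replicate r e₁ ++ replicate n′ e₀)))))

⊛-∷ʳ : ∀ v k w l → (v ++ [ k ]) ⊛ (w ++ [ l ]) ≡ map (_++ [ k + l ]) (v *h w)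
⊛-∷ʳ v k w l = go (v ++ [ k ]) (w ++ [ l ]) refl refl
  where
  go : ∀ xs ys → xs ≡ v ++ [ k ] → ys ≡ w ++ [ l ] → xs ⊛ ys ≡ map (_++ [ k + l ]) (v *h w)
  go xs ys xs≡ ys≡ with snocView xs | snocView ys
  ... | nil        | _          = ⊥-elim (∷ʳ≢[] [] (List.++-conicalʳ v [ k ] (sym xs≡)))
  ... | snoc _ _   | nil        = ⊥-elim (∷ʳ≢[] [] (List.++-conicalʳ w [ l ] (sym ys≡)))
  ... | snoc v′ k′ | snoc w′ l′ with List.∷ʳ-injective v′ v xs≡ | List.∷ʳ-injective w′ w ys≡
  ...   | refl , refl | refl , refl = refl

ones-∷ʳ : ∀ α → ones (suc α) ≡ ones α ++ [ 1 ]
ones-∷ʳ zero    = refl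
ones-∷ʳ (suc α) = cong (1 ∷_) (ones-∷ʳ α)

ones*h[] : ∀ α → ones α *h [] ≡ [ ones α ]
ones*h[] zero    = refl
ones*h[] (suc α) = refl

Split : Set
Split = Index × ℕ

unsplit : Split → Index
unsplit (w , l) = w ++ [ l ]

consSplit : ℕ → Split → Split
consSplit c (w , l) = c ∷ w , l

incHead : Split → Split
incHead ([]    , l) = [] , suc l
incHead (c ∷ w , l) = suc c ∷ w , l

harmonicSplit : ℕ → Split → List Index
harmonicSplit α (w , l) = map (_++ [ suc l ]) (ones α *h w)

-- The terms of harmonicSplit (1 + α) m whose first entry is the first entry of m.
harmonicSplitHead : ℕ → Split → List Index
harmonicSplitHead α ([]    , l) = []
harmonicSplitHead α (c ∷ w , l) = map (_++ [ suc l ]) (map (c ∷_) (ones α *h w))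

ones⊛unsplit : ∀ α m → ones (suc α) ⊛ unsplit m ≡ harmonicSplit α m
ones⊛unsplit α (w , l) = trans (cong (_⊛ (w ++ [ l ])) (ones-∷ʳ α)) (⊛-∷ʳ (ones α) 1 w l)

harmonicSplit-suc : ∀ α m →
  harmonicSplit (suc α) m ≡ harmonicSplitHead α (consSplit 1 m) ++ harmonicSplitHead (suc α) m ++ harmonicSplitHead α (incHead m)
harmonicSplit-suc α ([] , l) =
  trans (cong (λ ws → map (_++ [ suc l ]) (map (1 ∷_) ws)) (sym (ones*h[] α))) (sym (List.++-identityʳ _))
harmonicSplit-suc α (c ∷ w , l) = trans (List.map-++ (_++ [ suc l ]) (map (1 ∷_) (ones α *h (c ∷ w))) _)
  (cong (map (_++ [ suc l ]) (map (1 ∷_) (ones α *h (c ∷ w))) ++_) (List.map-++ (_++ [ suc l ]) (map (c ∷_) (ones (suc α) *h w)) _))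

module IndexSide (n : ℕ) where

  -- starFrom acc (1^β, n), each term split into its front and its last entry
  starSplits : ℕ → ℕ → List Split
  starSplits acc zero    = ([ acc ] , n) ∷ ([] , acc + n) ∷ []
  starSplits acc (suc β) = map (consSplit acc) (starSplits 1 β) ++ starSplits (acc + 1) β

  starFrom≡starSplits : ∀ acc β → starFrom acc (ones β ++ [ n ]) ≡ map unsplit (starSplits acc β)
  starFrom≡starSplits acc zero    = refl
  starFrom≡starSplits acc (suc β) = trans
    (cong₂ _++_ (trans (cong (map (acc ∷_)) (starFrom≡starSplits 1 β))
                       (trans (sym (List.map-∘ (starSplits 1 β))) (List.map-∘ {g = unsplit} (starSplits 1 β))))
                (starFrom≡starSplits (acc + 1) β))
    (sym (List.map-++ unsplit (map (consSplit acc) (starSplits 1 β)) _))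

  starSplits-suc : ∀ acc β → starSplits (suc acc) β ≡ map incHead (starSplits acc β)
  starSplits-suc acc zero    = refl
  starSplits-suc acc (suc β) = trans
    (cong₂ _++_ (List.map-∘ {g = incHead} {f = consSplit acc} (starSplits 1 β)) (starSplits-suc (acc + 1) β))
    (sym (List.map-++ incHead (map (consSplit acc) (starSplits 1 β)) _))

  ⊛star≡harmonicSplits : ∀ α β → ⊛star (ones (suc α)) (ones (suc β) ++ [ n ]) ≡ concatMap (harmonicSplit α) (starSplits 1 β)
  ⊛star≡harmonicSplits α β = begin
      concatMap (ones (suc α) ⊛_) (starFrom 1 (ones β ++ [ n ]))
    ≡⟨ cong (concatMap (ones (suc α) ⊛_)) (starFrom≡starSplits 1 β) ⟩
      concatMap (ones (suc α) ⊛_) (map unsplit (starSplits 1 β))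
    ≡⟨ List.concatMap-map (ones (suc α) ⊛_) unsplit (starSplits 1 β) ⟩
      concatMap (λ m → ones (suc α) ⊛ unsplit m) (starSplits 1 β)
    ≡⟨ List.concatMap-cong (ones⊛unsplit α) (starSplits 1 β) ⟩
      concatMap (harmonicSplit α) (starSplits 1 β)
    ∎
    where open ≡-Reasoning

  -- exactly one split in starSplits acc β has an empty front: the full sum (β + acc + n)
  harmonicSplits-0 : ∀ acc β → concatMap (harmonicSplit 0) (starSplits acc β)
    ↭ concatMap (harmonicSplitHead 0) (starSplits acc β) ++ [ [ suc (β + acc + n) ] ]
  harmonicSplits-0 acc zero    = ↭-refl
  harmonicSplits-0 acc (suc β) = begin
      concatMap (harmonicSplit 0) (front ++ back)
    ≡⟨ List.concatMap-++ (harmonicSplit 0) front back ⟩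
      concatMap (harmonicSplit 0) front ++ concatMap (harmonicSplit 0) back
    ≡⟨ cong (_++ concatMap (harmonicSplit 0) back) (fronts-agree (starSplits 1 β)) ⟩
      concatMap (harmonicSplitHead 0) front ++ concatMap (harmonicSplit 0) back
    ↭⟨ ++⁺ˡ (concatMap (harmonicSplitHead 0) front) (harmonicSplits-0 (acc + 1) β) ⟩
      concatMap (harmonicSplitHead 0) front ++ concatMap (harmonicSplitHead 0) back ++ [ [ suc (β + (acc + 1) + n) ] ]
    ↭⟨ ↭-sym (++-assoc (concatMap (harmonicSplitHead 0) front) _ _) ⟩
      (concatMap (harmonicSplitHead 0) front ++ concatMap (harmonicSplitHead 0) back) ++ [ [ suc (β + (acc + 1) + n) ] ]
    ≡⟨ cong₂ (λ xs i → xs ++ [ [ suc (i + n) ] ]) (sym (List.concatMap-++ (harmonicSplitHead 0) front back))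
             (trans (cong (β +_) (ℕ.+-comm acc 1)) (ℕ.+-suc β acc)) ⟩
      concatMap (harmonicSplitHead 0) (front ++ back) ++ [ [ suc (suc β + acc + n) ] ]
    ∎
    where
    open PermutationReasoning
    front = map (consSplit acc) (starSplits 1 β)
    back  = starSplits (acc + 1) β
    fronts-agree : ∀ ms → concatMap (harmonicSplit 0) (map (consSplit acc) ms) ≡ concatMap (harmonicSplitHead 0) (map (consSplit acc) ms)
    fronts-agree []       = refl
    fronts-agree (m ∷ ms) = cong (harmonicSplit 0 (consSplit acc m) ++_) (fronts-agree ms)

  indexTerms : ℕ → ℕ → List Index
  indexTerms zero    β = [ [ suc (β + n) ] ]
  indexTerms (suc α) β = concatMap (harmonicSplitHead α) (starSplits 1 β)

  ⊛star-recurrence : ∀ α β → ⊛star (ones (suc α)) (ones (suc β) ++ [ n ]) ↭ indexTerms α (suc β) ++ indexTerms (suc α) β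
  ⊛star-recurrence zero β = begin
      ⊛star (ones 1) (ones (suc β) ++ [ n ])
    ≡⟨ ⊛star≡harmonicSplits 0 β ⟩
      concatMap (harmonicSplit 0) (starSplits 1 β)
    ↭⟨ harmonicSplits-0 1 β ⟩
      indexTerms 1 β ++ [ [ suc (β + 1 + n) ] ]
    ↭⟨ ++-comm (indexTerms 1 β) _ ⟩
      [ [ suc (β + 1 + n) ] ] ++ indexTerms 1 β
    ≡⟨ cong (λ i → [ [ suc (i + n) ] ] ++ indexTerms 1 β) (ℕ.+-comm β 1) ⟩
      indexTerms 0 (suc β) ++ indexTerms 1 β
    ∎
    where open PermutationReasoning
  ⊛star-recurrence (suc α) β = begin
      ⊛star (ones (2 + α)) (ones (suc β) ++ [ n ])
    ≡⟨ ⊛star≡harmonicSplits (suc α) β ⟩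
      concatMap (harmonicSplit (suc α)) L
    ≡⟨ List.concatMap-cong (harmonicSplit-suc α) L ⟩
      concatMap (λ m → H α (consSplit 1 m) ++ H (suc α) m ++ H α (incHead m)) L
    ↭⟨ ↭-trans (concatMap-++-distrib _ _ L) (++⁺ˡ (concatMap (λ m → H α (consSplit 1 m)) L) (concatMap-++-distrib _ _ L)) ⟩
      concatMap (λ m → H α (consSplit 1 m)) L ++ concatMap (H (suc α)) L ++ concatMap (λ m → H α (incHead m)) L
    ↭⟨ ++⁺ˡ (concatMap (λ m → H α (consSplit 1 m)) L) (++-comm (concatMap (H (suc α)) L) _) ⟩
      concatMap (λ m → H α (consSplit 1 m)) L ++ concatMap (λ m → H α (incHead m)) L ++ concatMap (H (suc α)) L
    ↭⟨ ↭-sym (++-assoc (concatMap (λ m → H α (consSplit 1 m)) L) _ _) ⟩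
      (concatMap (λ m → H α (consSplit 1 m)) L ++ concatMap (λ m → H α (incHead m)) L) ++ concatMap (H (suc α)) L
    ≡⟨ cong (_++ concatMap (H (suc α)) L) heads ⟩
      indexTerms (suc α) (suc β) ++ indexTerms (2 + α) β
    ∎
    where
    open PermutationReasoning
    H = harmonicSplitHead
    L = starSplits 1 β
    heads : concatMap (λ m → H α (consSplit 1 m)) L ++ concatMap (λ m → H α (incHead m)) L
          ≡ concatMap (H α) (starSplits 1 (suc β))
    heads = sym (trans (List.concatMap-++ (H α) (map (consSplit 1) L) (starSplits 2 β))
      (cong₂ _++_ (List.concatMap-map (H α) (consSplit 1) L)
                  (trans (cong (concatMap (H α)) (starSplits-suc 1 β)) (List.concatMap-map (H α) incHead L))))

  ⊛star-base : ∀ α → ⊛star (ones (suc α)) (ones 0 ++ [ n ]) ≡ indexTerms α 0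
  ⊛star-base zero    = refl
  ⊛star-base (suc α) = begin
      (ones (2 + α) ⊛ [ n ]) ++ []
    ≡⟨ List.++-identityʳ _ ⟩
      ones (2 + α) ⊛ unsplit ([] , n)
    ≡⟨ ones⊛unsplit (suc α) ([] , n) ⟩
      harmonicSplit (suc α) ([] , n)
    ≡⟨ harmonicSplit-suc α ([] , n) ⟩
      indexTerms (suc α) 0
    ∎
    where open ≡-Reasoning

lastAtLeast2-∷ : ∀ x {v} → v ≢ [] → lastAtLeast2 (x ∷ v) ≡ lastAtLeast2 v
lastAtLeast2-∷ x {[]}    v≢[] = ⊥-elim (v≢[] refl)
lastAtLeast2-∷ x {_ ∷ _} _    = refl

comps-nonempty : ∀ q k → All (_≢ []) (comps (suc q) k)
comps-nonempty q k = All.concat⁺ (All.map⁺ (All.universal nonempty-column (applyUpTo (λ i → i) k)))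
  where
  nonempty-column : ∀ c → All (_≢ []) (map (suc c ∷_) (comps q (k ∸ suc c)))
  nonempty-column c = All.map⁺ (All.universal (λ _ ()) (comps q (k ∸ suc c)))

admissibleComps-suc : ∀ q k →
  admissibleComps (suc (suc q)) k ≡ concatUpTo (λ c → map (suc c ∷_) (admissibleComps (suc q) (k ∸ suc c))) k
admissibleComps-suc q k = begin
    filterᵇ lastAtLeast2 (concatMap (λ c → map (suc c ∷_) (comps (suc q) (k ∸ suc c))) (applyUpTo (λ i → i) k))
  ≡⟨ filterᵇ-concatMap lastAtLeast2 _ (applyUpTo (λ i → i) k) ⟩
    concatMap (λ c → filterᵇ lastAtLeast2 (map (suc c ∷_) (comps (suc q) (k ∸ suc c)))) (applyUpTo (λ i → i) k)
  ≡⟨ List.concatMap-cong (λ c → trans (filterᵇ-map lastAtLeast2 (suc c ∷_) (comps (suc q) (k ∸ suc c)))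
       (cong (map (suc c ∷_)) (filterᵇ-cong-local _ {xs = comps (suc q) (k ∸ suc c)}
                                (All.map (lastAtLeast2-∷ (suc c)) (comps-nonempty q (k ∸ suc c))))))
       (applyUpTo (λ i → i) k) ⟩
    concatMap (λ c → map (suc c ∷_) (admissibleComps (suc q) (k ∸ suc c))) (applyUpTo (λ i → i) k)
  ≡⟨ concatMap-applyUpTo _ (λ i → i) k ⟩
    concatUpTo (λ c → map (suc c ∷_) (admissibleComps (suc q) (k ∸ suc c))) k
  ∎
  where open ≡-Reasoning

-- With at most q + 1 to distribute over q + 1 positive parts, every part is 1.
admissibleComps-≤ : ∀ q {k} → k ≤ suc q → admissibleComps (suc q) k ≡ []
admissibleComps-≤ zero    {zero}  _ = refl
admissibleComps-≤ zero    {suc zero} _ = refl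
admissibleComps-≤ zero    {suc (suc k)} (s≤s ())
admissibleComps-≤ (suc q) {k} k≤2+q = trans (admissibleComps-suc q k)
  (concatUpTo-[] k (λ {c} _ → cong (map (suc c ∷_)) (admissibleComps-≤ q (rest≤ k c k≤2+q))))
  where
  rest≤ : ∀ k c → k ≤ suc (suc q) → k ∸ suc c ≤ suc q
  rest≤ zero    c _           = z≤n
  rest≤ (suc k) c (s≤s k≤1+q) = ℕ.≤-trans (ℕ.m∸n≤m k c) k≤1+q

comps-1 : ∀ m → comps 1 (suc m) ≡ [ [ suc m ] ]
comps-1 m = begin
    concatMap F (applyUpTo (λ i → i) (suc m))
  ≡⟨ concatMap-applyUpTo F (λ i → i) (suc m) ⟩
    concatUpTo F (suc m)
  ≡⟨ cong (concatUpTo F) (ℕ.+-comm 1 m) ⟩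
    concatUpTo F (m + 1)
  ≡⟨ concatUpTo-+ F m 1 ⟩
    concatUpTo F m ++ F (m + 0) ++ []
  ≡⟨ cong₂ (λ xs ys → xs ++ ys ++ [])
           (concatUpTo-[] m (λ {c} c<m → cong (λ i → map (suc c ∷_) (comps 0 i)) (ℕ.+-∸-assoc 1 c<m)))
           (trans (cong (λ j → map (suc j ∷_) (comps 0 (m ∸ j))) (ℕ.+-identityʳ m))
                  (cong (λ i → map (suc m ∷_) (comps 0 i)) (ℕ.n∸n≡0 m))) ⟩
    [ [ suc m ] ]
  ∎
  where
  open ≡-Reasoning
  F : ℕ → List Index
  F c = map (suc c ∷_) (comps 0 (suc m ∸ suc c))

admissibleComps-1 : ∀ z → admissibleComps 1 (suc (suc z)) ≡ [ [ suc (suc z) ] ]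
admissibleComps-1 z = cong (filterᵇ lastAtLeast2) (comps-1 (suc z))

admissibleWords : ∀ q z → map indexWord (admissibleComps (suc q) (suc q + suc z))
                          ↭ map (λ u → e₁ ∷ u ++ [ e₀ ]) (shuffles (replicate z e₀) (replicate q e₁))
admissibleWords zero z = ↭-reflexive (begin
    map indexWord (admissibleComps 1 (suc (suc z)))
  ≡⟨ cong (map indexWord) (admissibleComps-1 z) ⟩
    [ e₁ ∷ replicate (suc z) e₀ ++ [] ]
  ≡⟨ cong (λ w → [ e₁ ∷ w ]) (trans (List.++-identityʳ _) (replicate-∷ʳ e₀ z)) ⟩
    [ e₁ ∷ replicate z e₀ ++ [ e₀ ] ]
  ≡⟨ cong (map (λ u → e₁ ∷ u ++ [ e₀ ])) (sym (shuffles-[]ʳ (replicate z e₀))) ⟩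
    map (λ u → e₁ ∷ u ++ [ e₀ ]) (shuffles (replicate z e₀) [])
  ∎)
  where open ≡-Reasoning
admissibleWords (suc q) z = begin
    map indexWord (admissibleComps (2 + q) K)
  ≡⟨ cong (map indexWord) (admissibleComps-suc q K) ⟩
    map indexWord (concatUpTo (λ c → map (suc c ∷_) (admissibleComps (suc q) (K ∸ suc c))) K)
  ≡⟨ map-concatUpTo-map indexWord (λ c → suc c ∷_) (λ c → admissibleComps (suc q) (K ∸ suc c)) K ⟩
    concatUpTo F K
  ≡⟨ trans (cong (concatUpTo F) (ℕ.+-comm (2 + q) (suc z))) (concatUpTo-+ F (suc z) (2 + q)) ⟩
    concatUpTo F (suc z) ++ concatUpTo (λ i → F (suc z + i)) (2 + q)
  ≡⟨ trans (cong (concatUpTo F (suc z) ++_) (concatUpTo-[] (2 + q) (λ {i} _ →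
             cong (map (λ v → eWord (suc (suc z + i)) ++ indexWord v)) (admissibleComps-≤ q (tooLong i)))))
           (List.++-identityʳ _) ⟩
    concatUpTo F (suc z)
  ↭⟨ concatUpTo-↭ (suc z) (λ c<1+z → F↭ (ℕ.≤-pred c<1+z)) ⟩
    concatUpTo (λ c → map (λ u → e₁ ∷ (replicate c e₀ ++ e₁ ∷ u) ++ [ e₀ ]) (S c)) (suc z)
  ≡⟨ sym (map-concatUpTo-map (λ u → e₁ ∷ u ++ [ e₀ ]) (λ c u → replicate c e₀ ++ e₁ ∷ u) S (suc z)) ⟩
    map (λ u → e₁ ∷ u ++ [ e₀ ]) (concatUpTo (λ c → map (λ u → replicate c e₀ ++ e₁ ∷ u) (S c)) (suc z))
  ↭⟨ map⁺ _ (↭-sym (shuffles-replicate-∷ e₀ e₁ (replicate q e₁) z)) ⟩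
    map (λ u → e₁ ∷ u ++ [ e₀ ]) (shuffles (replicate z e₀) (replicate (suc q) e₁))
  ∎
  where
  open PermutationReasoning
  K = 2 + q + suc z
  F : ℕ → List Word
  F c = map (λ v → eWord (suc c) ++ indexWord v) (admissibleComps (suc q) (K ∸ suc c))
  S : ℕ → List Word
  S c = shuffles (replicate (z ∸ c) e₀) (replicate q e₁)
  tooLong : ∀ i → K ∸ suc (suc z + i) ≤ suc q
  tooLong i = ℕ.≤-trans (ℕ.≤-reflexive (trans (sym (ℕ.∸-+-assoc (suc q + suc z) (suc z) i))
                                              (cong (_∸ i) (ℕ.m+n∸n≡m (suc q) (suc z)))))
                        (ℕ.m∸n≤m (suc q) i)
  F↭ : ∀ {c} → c ≤ z → F c ↭ map (λ u → e₁ ∷ (replicate c e₀ ++ e₁ ∷ u) ++ [ e₀ ]) (S c)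
  F↭ {c} c≤z = begin
      map (λ v → eWord (suc c) ++ indexWord v) (admissibleComps (suc q) (K ∸ suc c))
    ≡⟨ trans (List.map-∘ _) (cong (λ j → map (eWord (suc c) ++_) (map indexWord (admissibleComps (suc q) j)))
                                  (trans (ℕ.+-∸-assoc (suc q) (ℕ.m≤n⇒m≤1+n c≤z)) (cong (suc q +_) (ℕ.+-∸-assoc 1 c≤z)))) ⟩
      map (eWord (suc c) ++_) (map indexWord (admissibleComps (suc q) (suc q + suc (z ∸ c))))
    ↭⟨ map⁺ (eWord (suc c) ++_) (admissibleWords q (z ∸ c)) ⟩
      map (eWord (suc c) ++_) (map (λ u → e₁ ∷ u ++ [ e₀ ]) (S c))
    ≡⟨ trans (sym (List.map-∘ (S c)))
             (List.map-cong (λ u → cong (e₁ ∷_) (sym (List.++-assoc (replicate c e₀) (e₁ ∷ u) [ e₀ ]))) (S c)) ⟩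
      map (λ u → e₁ ∷ (replicate c e₀ ++ e₁ ∷ u) ++ [ e₀ ]) (S c)
    ∎

module FoldSum {c ℓ} (CM : CommutativeMonoid c ℓ) where
  open CommutativeMonoid CM renaming (refl to ≈-refl; sym to ≈-sym; trans to ≈-trans)
  open import Relation.Binary.Reasoning.Setoid setoid

  foldSum : {A : Set} → (A → Carrier) → List A → Carrier
  foldSum f = foldr (λ x acc → f x ∙ acc) ε

  foldSum-++ : ∀ {A : Set} (f : A → Carrier) xs ys → foldSum f (xs ++ ys) ≈ foldSum f xs ∙ foldSum f ys
  foldSum-++ f []       ys = ≈-sym (identityˡ _)
  foldSum-++ f (x ∷ xs) ys = ≈-trans (∙-congˡ (foldSum-++ f xs ys)) (≈-sym (assoc _ _ _))

  foldSum-↭ : ∀ {A : Set} (f : A → Carrier) {xs ys} → xs ↭ ys → foldSum f xs ≈ foldSum f ys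
  foldSum-↭ f Perm.refl          = ≈-refl
  foldSum-↭ f (Perm.prep x p)    = ∙-congˡ (foldSum-↭ f p)
  foldSum-↭ f (Perm.swap {xs} {ys} x y p) = begin
      f x ∙ (f y ∙ foldSum f xs)  ≈⟨ ≈-sym (assoc _ _ _) ⟩
      (f x ∙ f y) ∙ foldSum f xs  ≈⟨ ∙-cong (comm _ _) (foldSum-↭ f p) ⟩
      (f y ∙ f x) ∙ foldSum f ys  ≈⟨ assoc _ _ _ ⟩
      f y ∙ (f x ∙ foldSum f ys)  ∎
  foldSum-↭ f (Perm.trans p q)   = ≈-trans (foldSum-↭ f p) (foldSum-↭ f q)

module _ {c ℓ} (G : Group c ℓ) where
  open Group G renaming (sym to ≈-sym; trans to ≈-trans)
  open import Algebra.Properties.Group G using (∙-cancelʳ)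

  recurrence-unique : (F H : ℕ → ℕ → Carrier) →
    (∀ r p → F r (suc p) ∙ F (suc r) p ≈ H r (suc p) ∙ H (suc r) p) → (∀ r → F r 0 ≈ H r 0) →
    ∀ p r → F r p ≈ H r p
  recurrence-unique F H step base zero    r = base r
  recurrence-unique F H step base (suc p) r = ∙-cancelʳ (F (suc r) p) (F r (suc p)) (H r (suc p))
    (≈-trans (step r p) (∙-congˡ (≈-sym (recurrence-unique F H step base p (suc r)))))

module _ {m ℓm} (M : ℚModule m ℓm) (Z : Word → Module.Carrierᴹ M)
  (hyp : ∀ (𝐤 𝐥 : Index) → 𝐤 ≢ [] → 𝐥 ≢ [] → All (1 ≤_) 𝐤 → All (1 ≤_) 𝐥
        → Module._≈ᴹ_ M (Zsum M Z (μ 𝐤 𝐥)) (Zidx M Z (⊛star 𝐤 𝐥))) where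

  open Module M
  open FoldSum +ᴹ-commutativeMonoid
  open import Relation.Binary.Reasoning.Setoid ≈ᴹ-setoid

  Zidx-↭ : ∀ {xs ys} → xs ↭ ys → Zidx M Z xs ≈ᴹ Zidx M Z ys
  Zidx-↭ xs↭ys = foldSum-↭ Z (map⁺ indexWord xs↭ys)

  Zidx-++ : ∀ xs ys → Zidx M Z (xs ++ ys) ≈ᴹ Zidx M Z xs +ᴹ Zidx M Z ys
  Zidx-++ xs ys = ≈ᴹ-trans (≈ᴹ-reflexive (cong (Zsum M Z) (List.map-++ indexWord xs ys))) (foldSum-++ Z (map indexWord xs) _)

  module _ (n′ : ℕ) where
    open WordSide n′
    open IndexSide (suc n′)

    hypothesis-ones : ∀ r p →
      Zsum M Z (μ (ones (suc r)) (ones p ++ [ suc n′ ])) ≈ᴹ Zidx M Z (⊛star (ones (suc r)) (ones p ++ [ suc n′ ]))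
    hypothesis-ones r p = hyp _ _ (λ ()) (∷ʳ≢[] (ones p)) (All.replicate⁺ (suc r) (s≤s z≤n))
                       (All.++⁺ (All.replicate⁺ p (s≤s z≤n)) (s≤s z≤n ∷ []))

    words≈indices : ∀ q r → Zsum M Z (wordTerms r q) ≈ᴹ Zidx M Z (indexTerms r q)
    words≈indices = recurrence-unique +ᴹ-group (λ r p → Zsum M Z (wordTerms r p)) (λ r p → Zidx M Z (indexTerms r p)) step base
      where
      step : ∀ r p → Zsum M Z (wordTerms r (suc p)) +ᴹ Zsum M Z (wordTerms (suc r) p)
                   ≈ᴹ Zidx M Z (indexTerms r (suc p)) +ᴹ Zidx M Z (indexTerms (suc r) p)
      step r p = begin
          Zsum M Z (wordTerms r (suc p)) +ᴹ Zsum M Z (wordTerms (suc r) p)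
        ≈⟨ ≈ᴹ-sym (foldSum-++ Z (wordTerms r (suc p)) _) ⟩
          Zsum M Z (wordTerms r (suc p) ++ wordTerms (suc r) p)
        ≈⟨ ≈ᴹ-sym (foldSum-↭ Z (μ-recurrence r p)) ⟩
          Zsum M Z (μ (ones (suc r)) (ones (suc p) ++ [ suc n′ ]))
        ≈⟨ hypothesis-ones r (suc p) ⟩
          Zidx M Z (⊛star (ones (suc r)) (ones (suc p) ++ [ suc n′ ]))
        ≈⟨ Zidx-↭ (⊛star-recurrence r p) ⟩
          Zidx M Z (indexTerms r (suc p) ++ indexTerms (suc r) p)
        ≈⟨ Zidx-++ (indexTerms r (suc p)) _ ⟩
          Zidx M Z (indexTerms r (suc p)) +ᴹ Zidx M Z (indexTerms (suc r) p)
        ∎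
      base : ∀ r → Zsum M Z (wordTerms r 0) ≈ᴹ Zidx M Z (indexTerms r 0)
      base r = begin
          Zsum M Z (wordTerms r 0)
        ≈⟨ ≈ᴹ-sym (foldSum-↭ Z (μ-base r)) ⟩
          Zsum M Z (μ (ones (suc r)) (ones 0 ++ [ suc n′ ]))
        ≈⟨ hypothesis-ones r 0 ⟩
          Zidx M Z (⊛star (ones (suc r)) (ones 0 ++ [ suc n′ ]))
        ≡⟨ cong (Zidx M Z) (⊛star-base r) ⟩
          Zidx M Z (indexTerms r 0)
        ∎

    admissibleSum≈single : ∀ q′ →
      Zidx M Z (admissibleComps (suc q′) (suc q′ + suc n′)) ≈ᴹ Z (indexWord [ suc q′ + suc n′ ])
    admissibleSum≈single q′ = begin
        Zidx M Z (admissibleComps (suc q′) (suc q′ + suc n′))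
      ≈⟨ foldSum-↭ Z (admissibleWords q′ n′) ⟩
        Zsum M Z (wordTerms 0 q′)
      ≈⟨ words≈indices q′ 0 ⟩
        Z (indexWord [ suc q′ + suc n′ ]) +ᴹ 0ᴹ
      ≈⟨ +ᴹ-identityʳ _ ⟩
        Z (indexWord [ suc q′ + suc n′ ])
      ∎

corollary7p2 : ∀ {m ℓm} (M : ℚModule m ℓm) (Z : Word → Module.Carrierᴹ M)
    → (∀ (𝐤 𝐥 : Index) → 𝐤 ≢ [] → 𝐥 ≢ [] → All (1 ≤_) 𝐤 → All (1 ≤_) 𝐥
        → Module._≈ᴹ_ M (Zsum M Z (μ 𝐤 𝐥)) (Zidx M Z (⊛star 𝐤 𝐥)))
    → ∀ (k q : ℕ) → 0 < q → q < k
    → Module._≈ᴹ_ M (Zidx M Z (admissibleComps q k)) (Z (indexWord [ k ]))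
corollary7p2 M Z hyp k (suc q′) _ q<k with ℕ.m≤n⇒∃[o]m+o≡n q<k
... | n′ , refl = subst (λ k → Module._≈ᴹ_ M (Zidx M Z (admissibleComps (suc q′) k)) (Z (indexWord [ k ])))
                           (ℕ.+-suc (suc q′) n′) (admissibleSum≈single M Z hyp n′ q′)
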